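{- Let $q,q'\geq 2$ and let $\gamma$ be an integer. A completely regular code in the graph $H(1,q)\square H(1,q')$ with covering radius $1$, eigenvalue $-2$ and parameter $\gamma$ exists if and only if $\frac{\gamma q}{q+q'}$ is an integer and $0<\frac{\gamma q}{q+q'}<q$.
   Context: $H(1,m)$ denotes the complete graph on $m$ vertices, and $\Gamma\square\Gamma'$ the Cartesian product of graphs (vertex set $V(\Gamma)\times V(\Gamma')$, $(u,u')\sim(v,v')$ iff either $u=v$ and $u'\sim v'$, or $u'=v'$ and $u\sim v$). The graph $H(1,q)\square H(1,q')$ is $(q+q'-2)$-regular. For a $k$-regular graph, a set $C$ of vertices is a completely regular code with covering radius $1$ if $C$ is a nonempty proper subset and there are integers $\beta,\gamma\geq1$ such that every vertex of $C$ has exactly $\beta$ neighbours outside $C$ and every vertex outside $C$ has exactly $\gamma$ neighbours in $C$; its eigenvalues (those of the intersection matrix $\begin{pmatrix}k-\beta&\beta\\ \gamma&k-\gamma\end{pmatrix}$) are $k$ and $k-(\beta+\gamma)$, and "eigenvalue $-2$" means $k-(\beta+\gamma)=-2$. -}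

module Defs where

open import Data.Bool using (Bool; true; false; not; _∧_; _∨_; if_then_else_)
open import Data.Nat using (ℕ; _+_; _∸_)
open import Data.Fin using (Fin; _≟_)
open import Data.Product using (_×_; _,_; ∃-syntax)
open import Data.List using (List; []; _∷_; allFin; cartesianProduct)
open import Data.Integer using (ℤ; +_; -_; _-_; _≤_) renaming (_+_ to _+ℤ_)
open import Relation.Nullary.Decidable using (⌊_⌋)
open import Relation.Binary.PropositionalEquality using (_≡_)

count : {A : Set} → (A → Bool) → List A → ℕ
count p [] = 0
count p (x ∷ xs) = (if p x then 1 else 0) + count p xs

adjH1 : {m : ℕ} → Fin m → Fin m → Bool
adjH1 i j = not ⌊ i ≟ j ⌋

Vertex : ℕ → ℕ → Set
Vertex q q' = Fin q × Fin q'

vertices : (q q' : ℕ) → List (Vertex q q')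
vertices q q' = cartesianProduct (allFin q) (allFin q')

adj : {q q' : ℕ} → Vertex q q' → Vertex q q' → Bool
adj (u , u') (v , v') = (⌊ u ≟ v ⌋ ∧ adjH1 u' v') ∨ (⌊ u' ≟ v' ⌋ ∧ adjH1 u v)

Code : ℕ → ℕ → Set
Code q q' = Vertex q q' → Bool

nbrsIn : {q q' : ℕ} → Code q q' → Vertex q q' → ℕ
nbrsIn {q} {q'} C x = count (λ y → adj x y ∧ C y) (vertices q q')

nbrsOut : {q q' : ℕ} → Code q q' → Vertex q q' → ℕ
nbrsOut {q} {q'} C x = count (λ y → adj x y ∧ not (C y)) (vertices q q')

-- C is a completely regular code with covering radius 1 and parameters β, γ
record IsCRC1 (q q' : ℕ) (C : Code q q') (β γ : ℤ) : Set where
  field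
    nonempty : ∃[ x ] (C x ≡ true)
    proper   : ∃[ x ] (C x ≡ false)
    β≥1      : + 1 ≤ β
    γ≥1      : + 1 ≤ γ
    inC      : ∀ x → C x ≡ true  → + nbrsOut C x ≡ β
    outC     : ∀ x → C x ≡ false → + nbrsIn C x ≡ γ

valency : ℕ → ℕ → ℤ
valency q q' = + (q + q' ∸ 2)

-- C is a CRC with covering radius 1, eigenvalue k-(β+γ) = -2, and parameter γ
HasCRC1Eig-2 : (q q' : ℕ) (γ : ℤ) → Set
HasCRC1Eig-2 q q' γ =
  ∃[ C ] ∃[ β ] (IsCRC1 q q' C β γ × (valency q q' - (β +ℤ γ) ≡ - + 2))

module Submission where

-- A vertex (u,u') of H(1,q) □ H(1,q') is adjacent to exactly the other vertices of its row and of its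
-- column, so its number of neighbours in a set P is r_P(u) + c_P(u') - 2[(u,u') ∈ P], where r_P and c_P
-- are the row and column sizes of P. For a completely regular code C with β + γ = q + q' (eigenvalue -2)
-- this gives r_C(u) + c_C(u') = γ at every vertex, inside or outside C, so all rows of C have one size a
-- and all columns one size b; double counting gives qa = q'b, hence γq = b(q + q'), and 0 < b < q since
-- C is nonempty and proper. Conversely, with g = gcd(q,q'), q = sg and q' = tg, the coprimality of s and
-- s + t turns γs = b(s + t) into b = sd and γ = (s + t)d with 0 < d < g; the diagonal band
-- {(u,u') : (u + u') mod g < d} then has all row sizes td and all column sizes sd, which makes it a
-- completely regular code with these parameters.

open import Defs
open import Data.Nat.Properties hiding (_≟_)
open import Algebra.Properties.CommutativeMonoid.Sum +-0-commutativeMonoid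
  using (sum; sum-syntax; sum-cong-≗; sum-remove; ∑-distrib-+; ∑-comm; sum-replicate-zero)
open import Algebra.Properties.CommutativeSemigroup +-commutativeSemigroup
  using (interchange; xy∙z≈xz∙y)
open import Data.Bool using (Bool; true; false; not; _∧_; _∨_; if_then_else_)
open import Data.Bool.Properties using (not-injective)
open import Data.Fin using (Fin; zero; suc; toℕ; fromℕ<; punchIn; _≟_)
open import Data.Fin.Properties using (toℕ<n; punchInᵢ≢i)
open import Data.Integer as ℤ using (ℤ; +_; -[1+_]; _⊖_; +<+; +≤+)
import Data.Integer.Properties as ℤ
open import Data.List using (List; []; _∷_; _++_; map; tabulate; allFin; cartesianProduct)
open import Data.Nat using (ℕ; zero; suc; _+_; _*_; _∸_; _≤_; _<_; s≤s; z≤n; _<ᵇ_; NonZero; >-nonZero; ≢-nonZero)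
open import Data.Nat.DivMod using (_%_; m<n⇒m%n≡m; [m+n]%n≡m%n)
open import Data.Nat.Divisibility using (_∣_; divides; quotient; m∣n⇒n≡quotient*m; m∣n⇒n≡m*quotient; n/m≡quotient)
open import Data.Nat.GCD using (gcd; gcd[m,n]∣m; gcd[m,n]∣n; gcd[m,n]≢0)
open import Data.Nat.Coprimality as Coprime using (Coprime; coprime-/gcd; coprime-+; coprime-divisor)
open import Data.Nat.Tactic.RingSolver using (solve-∀)
open import Data.Product using (_×_; _,_; ∃-syntax; proj₁; proj₂)
import Data.Product as Product
open import Data.Sum using (inj₁)
open import Function using (_∘_; id; _⇔_; mk⇔; Equivalence)
open import Relation.Nullary.Decidable using (⌊_⌋; yes; no)
open import Relation.Nullary.Negation using (contradiction)
open import Relation.Binary.PropositionalEquality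

open ≡-Reasoning

-- Finite sums

ind : Bool → ℕ
ind b = if b then 1 else 0

∑-const : ∀ n c → ∑[ i < n ] c ≡ n * c
∑-const zero    c = refl
∑-const (suc n) c = cong (_+_ c) (∑-const n c)

∑-ind-not+∑-ind : ∀ {n} (p : Fin n → Bool) →
  ∑[ i < n ] ind (not (p i)) + ∑[ i < n ] ind (p i) ≡ n
∑-ind-not+∑-ind {n} p = begin
  ∑[ i < n ] ind (not (p i)) + ∑[ i < n ] ind (p i) ≡⟨ ∑-distrib-+ (ind ∘ not ∘ p) (ind ∘ p) ⟨
  ∑[ i < n ] (ind (not (p i)) + ind (p i))          ≡⟨ sum-cong-≗ (ind-not+ind ∘ p) ⟩
  ∑[ i < n ] 1                                      ≡⟨ ∑-const n 1 ⟩
  n * 1                                             ≡⟨ *-identityʳ n ⟩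
  n                                                 ∎
  where
  ind-not+ind : ∀ b → ind (not b) + ind b ≡ 1
  ind-not+ind true  = refl
  ind-not+ind false = refl

≤-∑ : ∀ {n} (f : Fin n → ℕ) i → f i ≤ sum f
≤-∑ {suc n} f i = subst (f i ≤_) (sym (sum-remove {i = i} f)) (m≤m+n (f i) _)

∑-ind-pos⇒∃ : ∀ {n} (p : Fin n → Bool) → 0 < ∑[ i < n ] ind (p i) → ∃[ i ] p i ≡ true
∑-ind-pos⇒∃ {suc n} p pos with p zero in p0
... | true  = zero , p0
... | false = Product.map suc id (∑-ind-pos⇒∃ (p ∘ suc) pos)

∑-update : ∀ {n} (u : Fin n) (g f : Fin n → ℕ) →
  ∑[ v < n ] (if ⌊ u ≟ v ⌋ then g v else f v) + f u ≡ g u + sum f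
∑-update {suc n} u g f = begin
  sum h + f u                              ≡⟨ cong (_+ f u) (sum-remove {i = u} h) ⟩
  h u + sum (h ∘ punchIn u) + f u          ≡⟨ cong₂ (λ x y → x + y + f u) h[u]≡g[u] (sum-cong-≗ h≡f-off-u) ⟩
  g u + sum (f ∘ punchIn u) + f u          ≡⟨ +-assoc (g u) _ (f u) ⟩
  g u + (sum (f ∘ punchIn u) + f u)        ≡⟨ cong (_+_ (g u)) (+-comm _ (f u)) ⟩
  g u + (f u + sum (f ∘ punchIn u))        ≡⟨ cong (_+_ (g u)) (sum-remove {i = u} f) ⟨
  g u + sum f                              ∎
  where
  h : Fin (suc n) → ℕ
  h v = if ⌊ u ≟ v ⌋ then g v else f v
  h[u]≡g[u] : h u ≡ g u
  h[u]≡g[u] with u ≟ u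
  ... | yes _   = refl
  ... | no u≢u = contradiction refl u≢u
  h≡f-off-u : ∀ j → h (punchIn u j) ≡ f (punchIn u j)
  h≡f-off-u j with u ≟ punchIn u j
  ... | yes u≡u↑j = contradiction (sym u≡u↑j) (punchInᵢ≢i u j)
  ... | no _      = refl

∑-delta : ∀ {n} (u : Fin n) (g : Fin n → ℕ) → ∑[ v < n ] (if ⌊ u ≟ v ⌋ then g v else 0) ≡ g u
∑-delta {n} u g = begin
  ∑[ v < n ] (if ⌊ u ≟ v ⌋ then g v else 0)      ≡⟨ +-identityʳ _ ⟨
  ∑[ v < n ] (if ⌊ u ≟ v ⌋ then g v else 0) + 0  ≡⟨ ∑-update u g (λ _ → 0) ⟩
  g u + ∑[ v < n ] 0                              ≡⟨ cong (_+_ (g u)) (sum-replicate-zero n) ⟩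
  g u + 0                                         ≡⟨ +-identityʳ (g u) ⟩
  g u                                             ∎

∑-if : ∀ {n} b (f g : Fin n → ℕ) →
  ∑[ i < n ] (if b then f i else g i) ≡ (if b then sum f else sum g)
∑-if true  f g = refl
∑-if false f g = refl

∑-toℕ-+ : ∀ m n (h : ℕ → ℕ) →
  ∑[ j < m + n ] h (toℕ j) ≡ ∑[ j < m ] h (toℕ j) + ∑[ j < n ] h (m + toℕ j)
∑-toℕ-+ zero    n h = refl
∑-toℕ-+ (suc m) n h = trans (cong (_+_ (h 0)) (∑-toℕ-+ m n (h ∘ suc))) (sym (+-assoc (h 0) _ _))

∑-periodic : ∀ g (h : ℕ → ℕ) → (∀ c → h (c + g) ≡ h c) →
  ∀ c → ∑[ j < g ] h (c + toℕ j) ≡ ∑[ j < g ] h (toℕ j)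
∑-periodic g h periodic zero    = refl
∑-periodic g h periodic (suc c) = trans shift (∑-periodic g h periodic c)
  where
  -- Both sides are the window h c, …, h (c + g) with one end dropped, and h (c + g) = h c.
  shift : ∑[ j < g ] h (suc c + toℕ j) ≡ ∑[ j < g ] h (c + toℕ j)
  shift = +-cancelˡ-≡ (h c) _ _ (begin
    h c + ∑[ j < g ] h (suc c + toℕ j)
      ≡⟨ cong₂ _+_ (cong h (+-identityʳ c)) (sum-cong-≗ {g} λ j → cong h (+-suc c (toℕ j))) ⟨
    ∑[ j < suc g ] h (c + toℕ j)
      ≡⟨ cong (λ n → ∑[ j < n ] h (c + toℕ j)) (+-comm 1 g) ⟩
    ∑[ j < g + 1 ] h (c + toℕ j)
      ≡⟨ ∑-toℕ-+ g 1 (λ j → h (c + j)) ⟩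
    ∑[ j < g ] h (c + toℕ j) + (h (c + (g + 0)) + 0)
      ≡⟨ cong (_+_ (∑[ j < g ] h (c + toℕ j))) last≡h[c] ⟩
    ∑[ j < g ] h (c + toℕ j) + h c
      ≡⟨ +-comm _ (h c) ⟩
    h c + ∑[ j < g ] h (c + toℕ j)
      ∎)
    where
    last≡h[c] : h (c + (g + 0)) + 0 ≡ h c
    last≡h[c] = trans (+-identityʳ _) (trans (cong (λ k → h (c + k)) (+-identityʳ g)) (periodic c))

∑-ind-toℕ<ᵇ : ∀ {n d} → d ≤ n → ∑[ j < n ] ind (toℕ j <ᵇ d) ≡ d
∑-ind-toℕ<ᵇ {n} {zero}      _         = sum-replicate-zero n
∑-ind-toℕ<ᵇ {suc n} {suc d} (s≤s d≤n) = cong suc (∑-ind-toℕ<ᵇ d≤n)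

count-++ : ∀ {A : Set} (p : A → Bool) xs ys → count p (xs ++ ys) ≡ count p xs + count p ys
count-++ p []       ys = refl
count-++ p (x ∷ xs) ys = trans (cong (_+_ (ind (p x))) (count-++ p xs ys)) (sym (+-assoc (ind (p x)) _ _))

count-map : ∀ {A B : Set} (p : B → Bool) (f : A → B) xs → count p (map f xs) ≡ count (p ∘ f) xs
count-map p f []       = refl
count-map p f (x ∷ xs) = cong (_+_ (ind (p (f x)))) (count-map p f xs)

count-tabulate : ∀ {A : Set} {n} (p : A → Bool) (f : Fin n → A) →
  count p (tabulate f) ≡ ∑[ i < n ] ind (p (f i))
count-tabulate {n = zero}  p f = refl
count-tabulate {n = suc n} p f = cong (_+_ (ind (p (f zero)))) (count-tabulate p (f ∘ suc))

count-cartesianProduct : ∀ {A B : Set} {n} (p : A × B → Bool) (f : Fin n → A) (ys : List B) →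
  count p (cartesianProduct (tabulate f) ys) ≡ ∑[ i < n ] count (λ y → p (f i , y)) ys
count-cartesianProduct {n = zero}  p f ys = refl
count-cartesianProduct {n = suc n} p f ys = begin
  count p (map (f zero ,_) ys ++ cartesianProduct (tabulate (f ∘ suc)) ys)
    ≡⟨ count-++ p (map (f zero ,_) ys) _ ⟩
  count p (map (f zero ,_) ys) + count p (cartesianProduct (tabulate (f ∘ suc)) ys)
    ≡⟨ cong₂ _+_ (count-map p (f zero ,_) ys) (count-cartesianProduct p (f ∘ suc) ys) ⟩
  count (λ y → p (f zero , y)) ys + ∑[ i < n ] count (λ y → p (f (suc i) , y)) ys
    ∎

count-vertices : ∀ {q q'} (p : Vertex q q' → Bool) →
  count p (vertices q q') ≡ ∑[ v < q ] ∑[ v' < q' ] ind (p (v , v'))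
count-vertices {q} {q'} p =
  trans (count-cartesianProduct p id (allFin q')) (sum-cong-≗ λ v → count-tabulate (λ v' → p (v , v')) id)

-- Arithmetic

m-n≡-2⇔n≡m+2 : ∀ m n → (+ m ℤ.- + n ≡ ℤ.- + 2) ⇔ (n ≡ m + 2)
m-n≡-2⇔n≡m+2 m n = mk⇔
  (λ eq → ⊖≡-2⇒ m n (trans (sym (ℤ.[+m]-[+n]≡m⊖n m n)) eq))
  (λ { refl → trans (ℤ.[+m]-[+n]≡m⊖n m (m + 2))
                    (trans (cong (_⊖ (m + 2)) (sym (+-identityʳ m))) (ℤ.+-cancelˡ-⊖ m 0 2)) })
  where
  ⊖≡-2⇒ : ∀ m n → m ⊖ n ≡ -[1+ 1 ] → n ≡ m + 2
  ⊖≡-2⇒ zero    (suc .1) refl = refl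
  ⊖≡-2⇒ (suc m) (suc n) eq = cong suc (⊖≡-2⇒ m n (trans (sym (ℤ.[1+m]⊖[1+n]≡m⊖n m n)) eq))

scaling-ℤ⇒ℕ : ∀ {q q' γ m} → γ ℤ.* + q ≡ m ℤ.* + (q + q') → + 0 ℤ.< m → m ℤ.< + q →
  ∃[ G ] ∃[ b ] (γ ≡ + G × G * q ≡ b * (q + q') × 0 < b × b < q)
scaling-ℤ⇒ℕ {q} {q'} {+ G} {+ b} eq (+<+ 0<b) (+<+ b<q) =
  G , b , refl , ℤ.+-injective (trans (ℤ.pos-* G q) (trans eq (sym (ℤ.pos-* b (q + q'))))) , 0<b , b<q
scaling-ℤ⇒ℕ {suc q₀} {q'} { -[1+ n ]} {+ b} eq _ _ with () ← trans eq (sym (ℤ.pos-* b (suc q₀ + q')))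
scaling-ℤ⇒ℕ {zero} {γ = -[1+ n ]} {+ b} _ _ (+<+ ())

record Factorisation (q q' b G : ℕ) : Set where
  field
    g s t d   : ℕ
    q≡s*g     : q ≡ s * g
    q'≡t*g    : q' ≡ t * g
    b≡s*d     : b ≡ s * d
    G≡t*d+s*d : G ≡ t * d + s * d

factorise : ∀ {q q' b G} → 0 < q → G * q ≡ b * (q + q') → Factorisation q q' b G
factorise {q} {q'} {b} {G} 0<q G*q≡b*[q+q'] = record
  { g = g ; s = s ; t = t ; d = d
  ; q≡s*g = q≡s*g ; q'≡t*g = q'≡t*g ; b≡s*d = b≡s*d ; G≡t*d+s*d = G≡t*d+s*d }
  where
  g = gcd q q'
  instance
    g≢0 : NonZero g
    g≢0 = ≢-nonZero (gcd[m,n]≢0 q q' (inj₁ (m<n⇒n≢0 0<q)))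
  s = quotient (gcd[m,n]∣m q q')
  t = quotient (gcd[m,n]∣n q q')
  q≡s*g : q ≡ s * g
  q≡s*g = m∣n⇒n≡quotient*m (gcd[m,n]∣m q q')
  q'≡t*g : q' ≡ t * g
  q'≡t*g = m∣n⇒n≡quotient*m (gcd[m,n]∣n q q')
  instance
    s≢0 : NonZero s
    s≢0 = ≢-nonZero (λ s≡0 → m<n⇒n≢0 0<q (trans q≡s*g (cong (_* g) s≡0)))
  s⊥t : Coprime s t
  s⊥t = subst₂ Coprime (n/m≡quotient (gcd[m,n]∣m q q')) (n/m≡quotient (gcd[m,n]∣n q q'))
          (coprime-/gcd q q')
  G*s≡b*[s+t] : G * s ≡ b * (s + t)
  G*s≡b*[s+t] = *-cancelʳ-≡ (G * s) (b * (s + t)) g (begin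
    G * s * g         ≡⟨ *-assoc G s g ⟩
    G * (s * g)       ≡⟨ cong (G *_) q≡s*g ⟨
    G * q             ≡⟨ G*q≡b*[q+q'] ⟩
    b * (q + q')      ≡⟨ cong (b *_) (cong₂ _+_ q≡s*g q'≡t*g) ⟩
    b * (s * g + t * g) ≡⟨ cong (b *_) (*-distribʳ-+ g s t) ⟨
    b * ((s + t) * g) ≡⟨ *-assoc b (s + t) g ⟨
    b * (s + t) * g   ∎)
  s∣b : s ∣ b
  s∣b = coprime-divisor (Coprime.sym (coprime-+ (Coprime.sym s⊥t)))
          (divides G (trans (*-comm (s + t) b) (sym G*s≡b*[s+t])))
  d = quotient s∣b
  b≡s*d : b ≡ s * d
  b≡s*d = m∣n⇒n≡m*quotient s∣b
  G≡t*d+s*d : G ≡ t * d + s * d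
  G≡t*d+s*d = *-cancelʳ-≡ G (t * d + s * d) s (begin
    G * s                 ≡⟨ G*s≡b*[s+t] ⟩
    b * (s + t)           ≡⟨ cong (_* (s + t)) b≡s*d ⟩
    s * d * (s + t)       ≡⟨ rearrange s d t ⟩
    (t * d + s * d) * s   ∎)
    where
    rearrange : ∀ s d t → s * d * (s + t) ≡ (t * d + s * d) * s
    rearrange = solve-∀

-- Codes in H(1,q) □ H(1,q')

module _ {q q' : ℕ} where

  ∁ : Code q q' → Code q q'
  ∁ C x = not (C x)

  row : Code q q' → Fin q → ℕ
  row C u = ∑[ v' < q' ] ind (C (u , v'))

  col : Code q q' → Fin q' → ℕ
  col C u' = ∑[ v < q ] ind (C (v , u'))

  -- nbrsIn C is nbrs C and nbrsOut C is nbrs (∁ C), definitionally.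
  nbrs : Code q q' → Vertex q q' → ℕ
  nbrs P x = count (λ y → adj x y ∧ P y) (vertices q q')

  row-∁ : (C : Code q q') (u : Fin q) → row (∁ C) u + row C u ≡ q'
  row-∁ C u = ∑-ind-not+∑-ind (λ v' → C (u , v'))

  col-∁ : (C : Code q q') (u' : Fin q') → col (∁ C) u' + col C u' ≡ q
  col-∁ C u' = ∑-ind-not+∑-ind (λ v → C (v , u'))

  nbrs-in-row : (P : Code q q') (u v : Fin q) (u' : Fin q') →
    ∑[ v' < q' ] ind (adj (u , u') (v , v') ∧ P (v , v')) ≡
    (if ⌊ u ≟ v ⌋ then ∑[ v' < q' ] (if ⌊ u' ≟ v' ⌋ then 0 else ind (P (v , v')))
                  else ind (P (v , u')))
  nbrs-in-row P u v u' = begin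
    ∑[ v' < q' ] ind (adj (u , u') (v , v') ∧ P (v , v'))
      ≡⟨ sum-cong-≗ (λ v' → rook (⌊ u ≟ v ⌋) (⌊ u' ≟ v' ⌋) (P (v , v'))) ⟩
    ∑[ v' < q' ] (if ⌊ u ≟ v ⌋ then (if ⌊ u' ≟ v' ⌋ then 0 else ind (P (v , v')))
                               else (if ⌊ u' ≟ v' ⌋ then ind (P (v , v')) else 0))
      ≡⟨ ∑-if ⌊ u ≟ v ⌋ (λ v' → if ⌊ u' ≟ v' ⌋ then 0 else ind (P (v , v'))) (λ v' → if ⌊ u' ≟ v' ⌋ then ind (P (v , v')) else 0) ⟩
    (if ⌊ u ≟ v ⌋ then R else ∑[ v' < q' ] (if ⌊ u' ≟ v' ⌋ then ind (P (v , v')) else 0))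
      ≡⟨ cong (if ⌊ u ≟ v ⌋ then R else_) (∑-delta u' (λ v' → ind (P (v , v')))) ⟩
    (if ⌊ u ≟ v ⌋ then R else ind (P (v , u')))
      ∎
    where
    R = ∑[ v' < q' ] (if ⌊ u' ≟ v' ⌋ then 0 else ind (P (v , v')))
    rook : ∀ e e' p → ind (((e ∧ not e') ∨ (e' ∧ not e)) ∧ p) ≡
      (if e then (if e' then 0 else ind p) else (if e' then ind p else 0))
    rook true  true  p = refl
    rook true  false p = refl
    rook false true  p = refl
    rook false false p = refl

  -- (u , u') lies on its own row and column but is not its own neighbour.
  nbrs+2≡row+col : (P : Code q q') (u : Fin q) (u' : Fin q') →
    nbrs P (u , u') + ind (P (u , u')) + ind (P (u , u')) ≡ row P u + col P u'
  nbrs+2≡row+col P u u' = begin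
    nbrs P (u , u') + i + i
      ≡⟨ cong (λ n → n + i + i) (count-vertices (λ y → adj (u , u') y ∧ P y)) ⟩
    ∑[ v < q ] ∑[ v' < q' ] ind (adj (u , u') (v , v') ∧ P (v , v')) + i + i
      ≡⟨ cong (λ n → n + i + i) (sum-cong-≗ (λ v → nbrs-in-row P u v u')) ⟩
    ∑[ v < q ] (if ⌊ u ≟ v ⌋ then R v else ind (P (v , u'))) + i + i
      ≡⟨ cong (_+ i) (∑-update u R (λ v → ind (P (v , u')))) ⟩
    R u + col P u' + i
      ≡⟨ xy∙z≈xz∙y (R u) (col P u') i ⟩
    R u + i + col P u'
      ≡⟨ cong (_+ col P u') (∑-update u' (λ _ → 0) (λ v' → ind (P (u , v')))) ⟩
    row P u + col P u'
      ∎
    where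
    i = ind (P (u , u'))
    R : Fin q → ℕ
    R v = ∑[ v' < q' ] (if ⌊ u' ≟ v' ⌋ then 0 else ind (P (v , v')))

  nbrs≡row+col : (P : Code q q') {u : Fin q} {u' : Fin q'} →
    P (u , u') ≡ false → nbrs P (u , u') ≡ row P u + col P u'
  nbrs≡row+col P {u} {u'} u∉P = begin
    nbrs P (u , u')                                         ≡⟨ +-identityʳ _ ⟨
    nbrs P (u , u') + 0                                     ≡⟨ +-identityʳ _ ⟨
    nbrs P (u , u') + 0 + 0                                 ≡⟨ cong (λ b → nbrs P (u , u') + ind b + ind b) u∉P ⟨
    nbrs P (u , u') + ind (P (u , u')) + ind (P (u , u'))   ≡⟨ nbrs+2≡row+col P u u' ⟩
    row P u + col P u'                                      ∎

  crc⇒row+col≡G : (C : Code q q') {B G : ℕ} → IsCRC1 q q' C (+ B) (+ G) → B + G ≡ q + q' →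
    ∀ u u' → row C u + col C u' ≡ G
  crc⇒row+col≡G C {B} {G} crc B+G≡q+q' u u' with C (u , u') in C[u,u']
  ... | false = trans (sym (nbrs≡row+col C C[u,u'])) (ℤ.+-injective (outC (u , u') C[u,u']))
    where open IsCRC1 crc
  ... | true  = +-cancelˡ-≡ B _ _ (begin
    B + (row C u + col C u')
      ≡⟨ cong (_+ (row C u + col C u')) ∁-row+col ⟨
    (row (∁ C) u + col (∁ C) u') + (row C u + col C u')
      ≡⟨ interchange (row (∁ C) u) (col (∁ C) u') (row C u) (col C u') ⟩
    (row (∁ C) u + row C u) + (col (∁ C) u' + col C u')
      ≡⟨ cong₂ _+_ (row-∁ C u) (col-∁ C u') ⟩
    q' + q ≡⟨ +-comm q' q ⟩
    q + q' ≡⟨ B+G≡q+q' ⟨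
    B + G  ∎)
    where
    open IsCRC1 crc
    ∁-row+col : row (∁ C) u + col (∁ C) u' ≡ B
    ∁-row+col = trans (sym (nbrs≡row+col (∁ C) (cong not C[u,u']))) (ℤ.+-injective (inC (u , u') C[u,u']))

  row+col≡G⇒scaling : (C : Code q q') {G : ℕ} → (∀ u u' → row C u + col C u' ≡ G) →
    {u₀ : Fin q} {u'₀ : Fin q'} → C (u₀ , u'₀) ≡ true →
    {u₁ : Fin q} {u'₁ : Fin q'} → C (u₁ , u'₁) ≡ false →
    ∃[ b ] (G * q ≡ b * (q + q') × 0 < b × b < q)
  row+col≡G⇒scaling C {G} row+col≡G {u₀} {u'₀} x₀∈C {u₁} {u'₁} x₁∉C =
    b , G*q≡b*[q+q'] , 0<b , b<q
    where
    a = row C u₀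
    b = col C u'₀
    rows : ∀ u → row C u ≡ a
    rows u = +-cancelʳ-≡ b _ _ (trans (row+col≡G u u'₀) (sym (row+col≡G u₀ u'₀)))
    cols : ∀ u' → col C u' ≡ b
    cols u' = +-cancelˡ-≡ a _ _ (trans (row+col≡G u₀ u') (sym (row+col≡G u₀ u'₀)))
    q*a≡q'*b : q * a ≡ q' * b
    q*a≡q'*b = begin
      q * a                     ≡⟨ ∑-const q a ⟨
      ∑[ u < q ] a              ≡⟨ sum-cong-≗ rows ⟨
      ∑[ u < q ] row C u        ≡⟨ ∑-comm (λ u u' → ind (C (u , u'))) ⟩
      ∑[ u' < q' ] col C u'     ≡⟨ sum-cong-≗ cols ⟩
      ∑[ u' < q' ] b            ≡⟨ ∑-const q' b ⟩
      q' * b                    ∎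
    G*q≡b*[q+q'] : G * q ≡ b * (q + q')
    G*q≡b*[q+q'] = begin
      G * q             ≡⟨ cong (_* q) (row+col≡G u₀ u'₀) ⟨
      (a + b) * q       ≡⟨ *-distribʳ-+ q a b ⟩
      a * q + b * q     ≡⟨ cong (_+ b * q) (trans (*-comm a q) q*a≡q'*b) ⟩
      q' * b + b * q    ≡⟨ cong (_+ b * q) (*-comm q' b) ⟩
      b * q' + b * q    ≡⟨ +-comm (b * q') (b * q) ⟩
      b * q + b * q'    ≡⟨ *-distribˡ-+ b q q' ⟨
      b * (q + q')      ∎
    0<b : 0 < b
    0<b = subst (λ x → ind x ≤ b) x₀∈C (≤-∑ (λ v → ind (C (v , u'₀))) u₀)
    b<q : b < q
    b<q = subst (b <_) (trans (cong (_+_ (col (∁ C) u'₁)) (sym (cols u'₁))) (col-∁ C u'₁))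
              (m<n+m b 0<∁col)
      where
      0<∁col : 0 < col (∁ C) u'₁
      0<∁col = subst (λ x → ind (not x) ≤ col (∁ C) u'₁) x₁∉C (≤-∑ (λ v → ind (∁ C (v , u'₁))) u₁)

  constant-line-sums⇒HasCRC1Eig-2 : (C : Code q q') {a b : ℕ} → (∀ u → row C u ≡ a) → (∀ u' → col C u' ≡ b) →
    0 < b → b < q → Fin q' → HasCRC1Eig-2 q q' (+ (a + b))
  constant-line-sums⇒HasCRC1Eig-2 C {a} {b} rows cols 0<b b<q u'₀ = C , + β , crc , eigenvalue
    where
    β = (q' ∸ a) + (q ∸ b)
    ∁-rows : ∀ u → row (∁ C) u ≡ q' ∸ a
    ∁-rows u = trans (sym (m+n∸n≡m _ (row C u))) (cong₂ _∸_ (row-∁ C u) (rows u))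
    ∁-cols : ∀ u' → col (∁ C) u' ≡ q ∸ b
    ∁-cols u' = trans (sym (m+n∸n≡m _ (col C u'))) (cong₂ _∸_ (col-∁ C u') (cols u'))
    member : ∃[ u ] C (u , u'₀) ≡ true
    member = ∑-ind-pos⇒∃ (λ v → C (v , u'₀)) (subst (0 <_) (sym (cols u'₀)) 0<b)
    non-member : ∃[ u ] ∁ C (u , u'₀) ≡ true
    non-member = ∑-ind-pos⇒∃ (λ v → ∁ C (v , u'₀)) (subst (0 <_) (sym (∁-cols u'₀)) (m<n⇒0<n∸m b<q))
    u₀ = proj₁ member
    crc : IsCRC1 q q' C (+ β) (+ (a + b))
    crc = record
      { nonempty = (u₀ , u'₀) , proj₂ member
      ; proper   = (proj₁ non-member , u'₀) , not-injective (proj₂ non-member)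
      ; β≥1      = +≤+ (≤-trans (m<n⇒0<n∸m b<q) (m≤n+m (q ∸ b) (q' ∸ a)))
      ; γ≥1      = +≤+ (≤-trans 0<b (m≤n+m b a))
      ; inC      = λ { (u , u') x∈C → cong +_ (trans (nbrs≡row+col (∁ C) (cong not x∈C))
                                                      (cong₂ _+_ (∁-rows u) (∁-cols u'))) }
      ; outC     = λ { (u , u') x∉C → cong +_ (trans (nbrs≡row+col C x∉C) (cong₂ _+_ (rows u) (cols u'))) }
      }
    a≤q' : a ≤ q'
    a≤q' = subst₂ _≤_ (rows u₀) (row-∁ C u₀) (m≤n+m (row C u₀) (row (∁ C) u₀))
    β+γ≡q+q' : β + (a + b) ≡ q + q'
    β+γ≡q+q' = begin
      (q' ∸ a) + (q ∸ b) + (a + b)   ≡⟨ interchange (q' ∸ a) (q ∸ b) a b ⟩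
      (q' ∸ a + a) + (q ∸ b + b)     ≡⟨ cong₂ _+_ (m∸n+n≡m a≤q') (m∸n+n≡m (<⇒≤ b<q)) ⟩
      q' + q                         ≡⟨ +-comm q' q ⟩
      q + q'                         ∎
    2≤q+q' : 2 ≤ q + q'
    2≤q+q' = ≤-trans (≤-trans (s≤s 0<b) b<q) (m≤m+n q q')
    eigenvalue : valency q q' ℤ.- (+ β ℤ.+ + (a + b)) ≡ ℤ.- + 2
    eigenvalue = Equivalence.from (m-n≡-2⇔n≡m+2 (q + q' ∸ 2) (β + (a + b)))
                   (trans β+γ≡q+q' (sym (m∸n+n≡m 2≤q+q')))

  HasCRC1Eig-2⇒scaling : 2 ≤ q + q' → ∀ {γ} → HasCRC1Eig-2 q q' γ →
    ∃[ G ] ∃[ b ] (γ ≡ + G × G * q ≡ b * (q + q') × 0 < b × b < q)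
  HasCRC1Eig-2⇒scaling 2≤q+q' {+ G} (C , + B , crc , eigenvalue) =
    G , Product.map₂ (refl ,_) (row+col≡G⇒scaling C (crc⇒row+col≡G C crc B+G≡q+q') x₀∈C x₁∉C)
    where
    open IsCRC1 crc
    x₀∈C = proj₂ nonempty
    x₁∉C = proj₂ proper
    B+G≡q+q' : B + G ≡ q + q'
    B+G≡q+q' = trans (Equivalence.to (m-n≡-2⇔n≡m+2 (q + q' ∸ 2) (B + G)) eigenvalue) (m∸n+n≡m 2≤q+q')
  HasCRC1Eig-2⇒scaling _ {+ G} (C , -[1+ n ] , crc , _) with () ← IsCRC1.β≥1 crc
  HasCRC1Eig-2⇒scaling _ { -[1+ n ]} (C , β , crc , _) with () ← IsCRC1.γ≥1 crc

-- Diagonal band codes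

module _ (g d : ℕ) .{{_ : NonZero g}} where

  in-band : ℕ → ℕ
  in-band c = ind (c % g <ᵇ d)

  ∑-in-band : d ≤ g → ∀ n c → ∑[ j < n * g ] in-band (c + toℕ j) ≡ n * d
  ∑-in-band d≤g zero    c = refl
  ∑-in-band d≤g (suc n) c = begin
    ∑[ j < g + n * g ] in-band (c + toℕ j)
      ≡⟨ ∑-toℕ-+ g (n * g) (λ j → in-band (c + j)) ⟩
    ∑[ j < g ] in-band (c + toℕ j) + ∑[ j < n * g ] in-band (c + (g + toℕ j))
      ≡⟨ cong₂ _+_ one-period (sum-cong-≗ {n * g} λ j → cong in-band (sym (+-assoc c g (toℕ j)))) ⟩
    d + ∑[ j < n * g ] in-band (c + g + toℕ j)
      ≡⟨ cong (_+_ d) (∑-in-band d≤g n (c + g)) ⟩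
    d + n * d
      ∎
    where
    one-period : ∑[ j < g ] in-band (c + toℕ j) ≡ d
    one-period = begin
      ∑[ j < g ] in-band (c + toℕ j)
        ≡⟨ ∑-periodic g in-band (λ c → cong (λ x → ind (x <ᵇ d)) ([m+n]%n≡m%n c g)) c ⟩
      ∑[ j < g ] in-band (toℕ j)
        ≡⟨ sum-cong-≗ (λ j → cong (λ x → ind (x <ᵇ d)) (m<n⇒m%n≡m (toℕ<n j))) ⟩
      ∑[ j < g ] ind (toℕ j <ᵇ d)
        ≡⟨ ∑-ind-toℕ<ᵇ d≤g ⟩
      d ∎

  band : ∀ {q q'} → Code q q'
  band (u , u') = (toℕ u + toℕ u') % g <ᵇ d

  band-row : ∀ {q q'} t → d ≤ g → q' ≡ t * g → (u : Fin q) → row (band {q} {q'}) u ≡ t * d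
  band-row t d≤g refl u = ∑-in-band d≤g t (toℕ u)

  band-col : ∀ {q q'} s → d ≤ g → q ≡ s * g → (u' : Fin q') → col (band {q} {q'}) u' ≡ s * d
  band-col s d≤g refl u' =
    trans (sum-cong-≗ {s * g} (λ v → cong in-band (+-comm (toℕ v) (toℕ u')))) (∑-in-band d≤g s (toℕ u'))

scaling⇒HasCRC1Eig-2 : ∀ {q q' G b} → Fin q' → G * q ≡ b * (q + q') → 0 < b → b < q →
  HasCRC1Eig-2 q q' (+ G)
scaling⇒HasCRC1Eig-2 {q} {q'} {G} {b} u'₀ G*q≡b*[q+q'] 0<b b<q =
  subst (HasCRC1Eig-2 q q' ∘ +_) (sym G≡t*d+s*d)
    (constant-line-sums⇒HasCRC1Eig-2 (band g d) (band-row g d t d≤g q'≡t*g) (band-col g d s d≤g q≡s*g)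
      (subst (0 <_) b≡s*d 0<b) (subst (_< q) b≡s*d b<q) u'₀)
  where
  open Factorisation (factorise {q} {q'} {b} {G} (<-trans 0<b b<q) G*q≡b*[q+q'])
  d<g : d < g
  d<g = *-cancelˡ-< s d g (subst₂ _<_ b≡s*d q≡s*g b<q)
  d≤g : d ≤ g
  d≤g = <⇒≤ d<g
  instance
    g≢0 : NonZero g
    g≢0 = >-nonZero (≤-trans (s≤s z≤n) d<g)

proposition3 : (q q' : ℕ) → 2 ≤ q → 2 ≤ q' → (γ : ℤ) →
    HasCRC1Eig-2 q q' γ ⇔
      (∃[ m ] ((γ ℤ.* + q ≡ m ℤ.* + (q + q')) × (+ 0 ℤ.< m) × (m ℤ.< + q)))
proposition3 q q' 2≤q 2≤q' γ = mk⇔ necessary sufficient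
  where
  necessary : HasCRC1Eig-2 q q' γ → ∃[ m ] ((γ ℤ.* + q ≡ m ℤ.* + (q + q')) × (+ 0 ℤ.< m) × (m ℤ.< + q))
  necessary crc with HasCRC1Eig-2⇒scaling (≤-trans 2≤q (m≤m+n q q')) crc
  ... | G , b , refl , G*q≡b*[q+q'] , 0<b , b<q =
    + b , trans (sym (ℤ.pos-* G q)) (trans (cong +_ G*q≡b*[q+q']) (ℤ.pos-* b (q + q'))) , +<+ 0<b , +<+ b<q
  sufficient : ∃[ m ] ((γ ℤ.* + q ≡ m ℤ.* + (q + q')) × (+ 0 ℤ.< m) × (m ℤ.< + q)) → HasCRC1Eig-2 q q' γ
  sufficient (m , eq , 0<m , m<q) with scaling-ℤ⇒ℕ {q} {q'} {γ} {m} eq 0<m m<q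
  ... | G , b , refl , G*q≡b*[q+q'] , 0<b , b<q =
    scaling⇒HasCRC1Eig-2 (fromℕ< (≤-trans (s≤s z≤n) 2≤q')) G*q≡b*[q+q'] 0<b b<q
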